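{- Let $G=(V,E,w)$ be a graph with matching $M$, let $V=L\cup R$ be a partition, and let $A = \{\{u,v\}\in M: u\in L, v\in R\}$ and $B=\{\{u,v\}\in E\setminus M: u\in L, v\in R\}$. Let $k\ge 1$, $W>0$, and let $\tau^A\in\mathbb{R}_{\ge0}^{k+1}$, $\tau^B\in\mathbb{R}_{\ge0}^{k}$ be sequences of nonnegative multiples of $\varepsilon^{12}$. Let $P$ be an alternating path in the layered graph $\mathcal{L}(\tau^A,\tau^B,W)$ (defined below), i.e. a path whose edges alternate between $X$ and $Y$. Let $S$ be the walk in $G$ obtained from $P$ by replacing each vertex $v^t$ by $v$ ($S$ need not be simple). Then the edges of $S$ can be decomposed into a single simple path and a collection of cycles in $G$, such that the edges of the path and the edges of each cycle alternate between $A$ and $B$.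
   Context: Layered graph $\mathcal{L}(\tau^A,\tau^B,W)=(V_{\mathcal L},E_{\mathcal L})$: $V_{\mathcal L}=\{v^t: v\in V, 1\le t\le k+1\}$ ($k+1$ copies of $V$; copy $t$ is "layer $t$"), and $E_{\mathcal L}=X\cup Y$ with $X=\{\{u^t,v^t\}: 1\le t\le k+1, \{u,v\}\in A, w(\{u,v\})\in((\tau^A_t-\varepsilon^{12})W, \tau^A_tW]\}$ and $Y=\{\{u^t,v^{t+1}\}: 1\le t\le k, \{u,v\}\in B, u\in R, v\in L, w(\{u,v\})\in[\tau^B_tW,(\tau^B_t+\varepsilon^{12})W)\}$. Then vertices are filtered: for $2\le t\le k$, remove $v^t$ if it is not incident to an edge of $X$; for a vertex $v^1$ with $v\in R$ not incident to an edge of $X$ in layer 1, keep it only if $v$ is not incident to $M$ and $\tau^A_1=0$ (otherwise remove it); symmetrically, for $v^{k+1}$ with $v\in L$ not incident to an edge of $X$ in layer $k+1$, keep it only if $v$ is not incident to $M$ and $\tau^A_{k+1}=0$. Edges incident to removed vertices are removed. -}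

module Defs where

open import Data.Nat using (ℕ; zero; suc; _≤ᵇ_; pred) renaming (_≤_ to _≤ℕ_; _<_ to _<ℕ_)
open import Data.Fin using (Fin; toℕ; inject₁) renaming (suc to fsuc)
open import Data.Bool using (Bool; true; false; if_then_else_)
open import Data.Product using (Σ; ∃; _×_; _,_; proj₁; proj₂)
open import Data.Sum using (_⊎_)
open import Data.List using (List; map; upTo; _++_; concatMap)
open import Data.List.Relation.Binary.Permutation.Propositional using (_↭_)
open import Relation.Nullary using (¬_)
open import Relation.Binary.PropositionalEquality using (_≡_)

-- Number operations: the paper's weights, W, ε, τ are reals.  The
-- stdlib has no reals, so we quantify over an arbitrary carrier K
-- with the needed operations/relations (ℝ is one instance).

pow : {K : Set} → K → (K → K → K) → K → ℕ → K
pow one _*_ x zero    = one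
pow one _*_ x (suc m) = x * pow one _*_ x m

-- Layers 1..k+1 of the paper are Fin (suc k) (layer t ↦ toℕ t + 1).
-- τᴮ_t (paper, t = 1..k) is τB i with i : Fin k (t = toℕ i + 1).

record Setting : Set₁ where
  infixl 6 _+_ _-_
  infixl 7 _*_
  infix 4 _<_ _≤_
  field
    K      : Set
    0# 1#  : K
    _+_ _-_ _*_ : K → K → K
    _<_ _≤_ : K → K → Set
    fromℕ  : ℕ → K
    ε      : K
    ε-pos  : 0# < ε
    n      : ℕ
    E      : Fin n → Fin n → Set
    E-sym  : ∀ {u v} → E u v → E v u
    E-irr  : ∀ {u} → ¬ E u u
    w      : Fin n → Fin n → K
    w-sym  : ∀ u v → w u v ≡ w v u
    M      : Fin n → Fin n → Set
    M-sym  : ∀ {u v} → M u v → M v u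
    M⊆E    : ∀ {u v} → M u v → E u v
    M-uniq : ∀ {u v v′} → M u v → M u v′ → v ≡ v′
    inL    : Fin n → Bool
    k      : ℕ
    k≥1    : 1 ≤ℕ k
    W      : K
    W-pos  : 0# < W
    τA     : Fin (suc k) → K
    τB     : Fin k → K
    τA-nonneg : ∀ t → 0# ≤ τA t
    τB-nonneg : ∀ t → 0# ≤ τB t
    τA-mult   : ∀ t → Σ ℕ λ j → τA t ≡ fromℕ j * pow 1# _*_ ε 12
    τB-mult   : ∀ t → Σ ℕ λ j → τB t ≡ fromℕ j * pow 1# _*_ ε 12

module _ (S : Setting) where
  open Setting S

  ε¹² : K
  ε¹² = pow 1# _*_ ε 12

  InL InR : Fin n → Set
  InL v = inL v ≡ true
  InR v = inL v ≡ false

  Unmatched : Fin n → Set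
  Unmatched v = ∀ u → ¬ M v u

  InA : Fin n → Fin n → Set
  InA u v = M u v × ((InL u × InR v) ⊎ (InR u × InL v))

  InB : Fin n → Fin n → Set
  InB u v = E u v × ¬ M u v × ((InL u × InR v) ⊎ (InR u × InL v))

  LV : Set
  LV = Fin n × Fin (suc k)

  Xedge : LV → LV → Set
  Xedge (u , t) (v , t′) =
    t ≡ t′ × InA u v ×
    ((τA t - ε¹²) * W < w u v) × (w u v ≤ τA t * W)

  Ydir : LV → LV → Set
  Ydir (u , t) (v , t′) = Σ (Fin k) λ i →
    t ≡ inject₁ i × t′ ≡ fsuc i × InB u v × InR u × InL v ×
    (τB i * W ≤ w u v) × (w u v < (τB i + ε¹²) * W)

  IncX : LV → Set
  IncX x = Σ LV λ y → Xedge x y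

  Kept : LV → Set
  Kept (v , t) =
    (toℕ t ≡ 0 →
       IncX (v , t) ⊎ (¬ IncX (v , t) × InL v)
       ⊎ (¬ IncX (v , t) × InR v × Unmatched v × τA t ≡ 0#))
    × (toℕ t ≡ k →
       IncX (v , t) ⊎ (¬ IncX (v , t) × InR v)
       ⊎ (¬ IncX (v , t) × InL v × Unmatched v × τA t ≡ 0#))
    × (1 ≤ℕ toℕ t → toℕ t <ℕ k → IncX (v , t))

  LX LY : LV → LV → Set
  LX a b = Kept a × Kept b × Xedge a b
  LY a b = Kept a × Kept b × (Ydir a b ⊎ Ydir b a)

  record AltPath : Set where
    field
      m     : ℕ
      p     : ℕ → LV
      inj   : ∀ i j → i ≤ℕ m → j ≤ℕ m → p i ≡ p j → i ≡ j
      edge  : ∀ i → suc i ≤ℕ m → LX (p i) (p (suc i)) ⊎ LY (p i) (p (suc i))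
      alt   : ∀ i → suc (suc i) ≤ℕ m →
                (LX (p i) (p (suc i)) × LY (p (suc i)) (p (suc (suc i))))
              ⊎ (LY (p i) (p (suc i)) × LX (p (suc i)) (p (suc (suc i))))

  -- canonical representative of the unordered edge {u,v}
  canon : Fin n → Fin n → Fin n × Fin n
  canon u v = if toℕ u ≤ᵇ toℕ v then (u , v) else (v , u)

  walkEdges : ℕ → (ℕ → Fin n) → List (Fin n × Fin n)
  walkEdges l q = map (λ i → canon (q i) (q (suc i))) (upTo l)

  S-edges : AltPath → List (Fin n × Fin n)
  S-edges P = walkEdges (AltPath.m P) (λ i → proj₁ (AltPath.p P i))

  AltAB : Fin n → Fin n → Fin n → Set
  AltAB a b c = (InA a b × InB b c) ⊎ (InB a b × InA b c)

  record AltGPath : Set where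
    field
      l    : ℕ
      q    : ℕ → Fin n
      inj  : ∀ i j → i ≤ℕ l → j ≤ℕ l → q i ≡ q j → i ≡ j
      edge : ∀ i → suc i ≤ℕ l → InA (q i) (q (suc i)) ⊎ InB (q i) (q (suc i))
      alt  : ∀ i → suc (suc i) ≤ℕ l → AltAB (q i) (q (suc i)) (q (suc (suc i)))

  record AltGCycle : Set where
    field
      c      : ℕ
      c≥3    : 3 ≤ℕ c
      q      : ℕ → Fin n
      closed : q c ≡ q 0
      inj    : ∀ i j → i <ℕ c → j <ℕ c → q i ≡ q j → i ≡ j
      edge   : ∀ i → suc i ≤ℕ c → InA (q i) (q (suc i)) ⊎ InB (q i) (q (suc i))
      alt    : ∀ i → suc (suc i) ≤ℕ c → AltAB (q i) (q (suc i)) (q (suc (suc i)))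
      wrap   : AltAB (q (pred c)) (q 0) (q 1)

  pathEdges : AltGPath → List (Fin n × Fin n)
  pathEdges π = walkEdges (AltGPath.l π) (AltGPath.q π)

  cycleEdges : AltGCycle → List (Fin n × Fin n)
  cycleEdges C = walkEdges (AltGCycle.c C) (AltGCycle.q C)

  Decomposes : List (Fin n × Fin n) → Set
  Decomposes es = Σ AltGPath λ π → Σ (List AltGCycle) λ cs →
    (pathEdges π ++ concatMap cycleEdges cs) ↭ es

-- Projecting the alternating layered path gives a walk in G whose edges alternate between A and B.
-- Cut the walk at its first repeated vertex: the closed piece is a cycle, and it alternates also
-- around its closing vertex because its length is even (each edge crosses the partition L ∪ R).
-- It cannot be a 2-cycle, since no edge lies in both A and B. Splicing the cycle out leaves a
-- shorter alternating walk, and induction on the length ends with a walk that is a simple path.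
module Submission where

open import Defs
open import Algebra.Properties.CommutativeSemigroup as CommSemigroupProperties using ()
open import Data.Bool using (Bool; true; false; not)
open import Data.Empty using (⊥-elim)
open import Data.Fin using (Fin)
import Data.Fin.Properties as Fin
open import Data.List using (List; []; _∷_; _++_; applyUpTo)
open import Data.List.Properties using (map-upTo; ++-assoc; ++-identityʳ)
open import Data.List.Relation.Binary.Permutation.Propositional
  using (↭-trans; ↭-reflexive)
open import Data.List.Relation.Binary.Permutation.Propositional.Properties using (shifts; ++⁺ˡ)
open import Data.Nat using (ℕ; zero; suc; pred; _+_; _≤_; _<_; z≤n; s≤s; z<s; s<s; _≤?_; anyUpTo?)
open import Data.Nat.Induction using (<-rec)
open import Data.Nat.Properties
  using ( ≤-refl; ≤-trans; ≤-reflexive; ≤-antisym; <⇒≤; <-≤-connex; m≤n⇒m≤1+n; m≤m+n; m≤n+m; m<m+n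
        ; +-comm; +-assoc; +-suc; +-monoˡ-≤; +-monoˡ-<; +-cancelʳ-≡; m≤n⇒∃[o]m+o≡n
        ; +-commutativeSemigroup; m≤n⇒m<n∨m≡n)
open import Data.Product using (Σ; _×_; _,_; proj₁)
open import Data.Sum using (_⊎_; inj₁; inj₂)
open import Function using (_∘_)
open import Relation.Nullary using (¬_; yes; no)
open import Relation.Binary.PropositionalEquality

open CommSemigroupProperties +-commutativeSemigroup using (xy∙z≈xz∙y)

applyUpTo-cong : ∀ {A : Set} (f g : ℕ → A) n → (∀ {i} → i < n → f i ≡ g i) →
                 applyUpTo f n ≡ applyUpTo g n
applyUpTo-cong f g zero    f≗g = refl
applyUpTo-cong f g (suc n) f≗g = cong₂ _∷_ (f≗g z<s) (applyUpTo-cong (f ∘ suc) (g ∘ suc) n (f≗g ∘ s<s))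

applyUpTo-++ : ∀ {A : Set} (f : ℕ → A) m n →
               applyUpTo f (m + n) ≡ applyUpTo f m ++ applyUpTo (λ i → f (m + i)) n
applyUpTo-++ f zero    n = refl
applyUpTo-++ f (suc m) n = cong (f 0 ∷_) (applyUpTo-++ (f ∘ suc) m n)

alternate : Bool → ℕ → Bool
alternate b zero    = b
alternate b (suc i) = not (alternate b i)

alternate-not : ∀ b i → alternate (not b) i ≡ not (alternate b i)
alternate-not b zero    = refl
alternate-not b (suc i) = cong not (alternate-not b i)

alternate-+ : ∀ b m n → alternate b (m + n) ≡ alternate (alternate b n) m
alternate-+ b zero    n = refl
alternate-+ b (suc m) n = cong not (alternate-+ b m n)

Even : ℕ → Set
Even d = ∀ b → alternate b d ≡ b

alternate-+-Even : ∀ b k {d} → Even d → alternate b (k + d) ≡ alternate b k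
alternate-+-Even b k {d} even = trans (alternate-+ b k d) (cong (λ c → alternate c k) (even b))

alternate-fixed⇒Even : ∀ b d → alternate b d ≡ b → Even d
alternate-fixed⇒Even true  d fixed true  = fixed
alternate-fixed⇒Even false d fixed false = fixed
alternate-fixed⇒Even true  d fixed false = trans (alternate-not true d) (cong not fixed)
alternate-fixed⇒Even false d fixed true  = trans (alternate-not false d) (cong not fixed)

module _ (S : Setting) where
  open Setting S using (n; inL; M-sym; E-sym)

  Vertex : Set
  Vertex = Fin n

  Edge : Bool → Vertex → Vertex → Set
  Edge true  = InA S
  Edge false = InB S

  record AlternatingWalk (b : Bool) (l : ℕ) (q : ℕ → Vertex) : Set where
    constructor alternating
    field
      step : ∀ i → suc i ≤ l → Edge (alternate b i) (q i) (q (suc i))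
  open AlternatingWalk

  InjectiveBelow : ℕ → (ℕ → Vertex) → Set
  InjectiveBelow N q = ∀ i j → i < N → j < N → q i ≡ q j → i ≡ j

  InA-InB-disjoint : ∀ {u v} → InA S u v → ¬ InB S u v
  InA-InB-disjoint (uv∈M , _) (_ , uv∉M , _) = uv∉M uv∈M

  InB-sym : ∀ {u v} → InB S u v → InB S v u
  InB-sym (uv∈E , uv∉M , inj₁ (u∈L , v∈R)) = E-sym uv∈E , uv∉M ∘ M-sym , inj₂ (v∈R , u∈L)
  InB-sym (uv∈E , uv∉M , inj₂ (u∈R , v∈L)) = E-sym uv∈E , uv∉M ∘ M-sym , inj₁ (v∈L , u∈R)

  crossing-flips-side : ∀ {u v} → (InL S u × InR S v) ⊎ (InR S u × InL S v) → inL v ≡ not (inL u)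
  crossing-flips-side (inj₁ (u∈L , v∈R)) rewrite u∈L | v∈R = refl
  crossing-flips-side (inj₂ (u∈R , v∈L)) rewrite u∈R | v∈L = refl

  Edge-flips-side : ∀ x {u v} → Edge x u v → inL v ≡ not (inL u)
  Edge-flips-side true  (_ , crossing)     = crossing-flips-side crossing
  Edge-flips-side false (_ , _ , crossing) = crossing-flips-side crossing

  Edge-irreversible : ∀ x {u v} → Edge x u v → ¬ Edge (not x) v u
  Edge-irreversible true  (uv∈M , _) (_ , vu∉M , _) = vu∉M (M-sym uv∈M)
  Edge-irreversible false (_ , uv∉M , _) (vu∈M , _) = uv∉M (M-sym vu∈M)

  Edge⇒A⊎B : ∀ x {u v} → Edge x u v → InA S u v ⊎ InB S u v
  Edge⇒A⊎B true  = inj₁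
  Edge⇒A⊎B false = inj₂

  Edge-altAB : ∀ x {u v w} → Edge x u v → Edge (not x) v w → AltAB S u v w
  Edge-altAB true  uv vw = inj₁ (uv , vw)
  Edge-altAB false uv vw = inj₂ (uv , vw)

  walk-side : ∀ {b l q} → AlternatingWalk b l q → ∀ k → k ≤ l → inL (q k) ≡ alternate (inL (q 0)) k
  walk-side         walk zero    _   = refl
  walk-side {b} walk (suc k) k<l =
    trans (Edge-flips-side (alternate b k) (step walk k k<l)) (cong not (walk-side walk k (<⇒≤ k<l)))

  closedWalk-even : ∀ {b c q} → AlternatingWalk b c q → q c ≡ q 0 → Even c
  closedWalk-even {c = c} {q} walk closed =
    alternate-fixed⇒Even (inL (q 0)) c (trans (sym (walk-side walk c ≤-refl)) (cong inL closed))

  closedWalk-length≥3 : ∀ {b c q} → AlternatingWalk b c q → q c ≡ q 0 → 0 < c → 3 ≤ c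
  closedWalk-length≥3 {c = 1} walk closed _ with closedWalk-even walk closed true
  ... | ()
  closedWalk-length≥3 {b} {c = 2} {q} walk closed _ =
    ⊥-elim (Edge-irreversible b (step walk 0 (s≤s z≤n)) (subst (Edge (not b) (q 1)) closed (step walk 1 ≤-refl)))
  closedWalk-length≥3 {c = suc (suc (suc _))} _ _ _ = s≤s (s≤s (s≤s z≤n))

  closedWalk-wrap : ∀ {b c q} → AlternatingWalk b c q → q c ≡ q 0 → 0 < c → AltAB S (q (pred c)) (q 0) (q 1)
  closedWalk-wrap {b} {suc c} {q} walk closed _ = Edge-altAB (alternate b c)
    (subst (Edge (alternate b c) (q c)) closed (step walk c ≤-refl))
    (subst (λ x → Edge x (q 0) (q 1)) (sym (closedWalk-even walk closed b)) (step walk 0 (s≤s z≤n)))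

  closedWalk⇒cycle : ∀ {b c q} → AlternatingWalk b c q → q c ≡ q 0 → InjectiveBelow c q → 0 < c →
                     AltGCycle S
  closedWalk⇒cycle {b} {c} {q} walk closed injective 0<c = record
    { c      = c
    ; c≥3    = closedWalk-length≥3 walk closed 0<c
    ; q      = q
    ; closed = closed
    ; inj    = injective
    ; edge   = λ i i<c → Edge⇒A⊎B (alternate b i) (step walk i i<c)
    ; alt    = λ i i+1<c → Edge-altAB (alternate b i) (step walk i (<⇒≤ i+1<c)) (step walk (suc i) i+1<c)
    ; wrap   = closedWalk-wrap walk closed 0<c
    }

  injectiveWalk⇒path : ∀ {b l q} → AlternatingWalk b l q → InjectiveBelow (suc l) q → AltGPath S
  injectiveWalk⇒path {b} {l} {q} walk injective = record
    { l    = l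
    ; q    = q
    ; inj  = λ i j i≤l j≤l → injective i j (s≤s i≤l) (s≤s j≤l)
    ; edge = λ i i<l → Edge⇒A⊎B (alternate b i) (step walk i i<l)
    ; alt  = λ i i+1<l → Edge-altAB (alternate b i) (step walk i (<⇒≤ i+1<l)) (step walk (suc i) i+1<l)
    }

  shiftWalk : ∀ {b l q} → AlternatingWalk b l q → ∀ i {m} → i + m ≤ l →
              AlternatingWalk (alternate b i) m (λ k → q (k + i))
  shiftWalk {b} {l} walk i {m} i+m≤l = alternating λ k k<m →
    subst (λ x → Edge x _ _) (alternate-+ b k i)
      (step walk (k + i) (≤-trans (+-monoˡ-≤ i k<m) (subst (_≤ l) (+-comm i m) i+m≤l)))

  shiftInjective : ∀ {q} i d → InjectiveBelow (i + d) q → InjectiveBelow d (λ k → q (k + i))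
  shiftInjective i d injective a b a<d b<d eq =
    +-cancelʳ-≡ i a b (injective (a + i) (b + i) (below a<d) (below b<d) eq)
    where
    below : ∀ {a} → a < d → a + i < i + d
    below {a} a<d = subst (a + i <_) (+-comm d i) (+-monoˡ-< i a<d)

  shortcut : (ℕ → Vertex) → ℕ → ℕ → ℕ → Vertex
  shortcut q i d k with k ≤? i
  ... | yes _ = q k
  ... | no  _ = q (k + d)

  shortcut-≤ : ∀ q {i d k} → k ≤ i → shortcut q i d k ≡ q k
  shortcut-≤ q {i} {k = k} k≤i with k ≤? i
  ... | yes _   = refl
  ... | no  k≰i = ⊥-elim (k≰i k≤i)

  shortcut-≥ : ∀ {q i d} → q i ≡ q (i + d) → ∀ {k} → i ≤ k → shortcut q i d k ≡ q (k + d)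
  shortcut-≥ {q} {i} {d} closes {k} i≤k with k ≤? i
  ... | yes k≤i = subst (λ j → q j ≡ q (j + d)) (≤-antisym i≤k k≤i) closes
  ... | no  _   = refl

  shortcut-alternating : ∀ {b i d r q} → AlternatingWalk b (i + d + r) q → q i ≡ q (i + d) → Even d →
                         AlternatingWalk b (i + r) (shortcut q i d)
  shortcut-alternating {b} {i} {d} {r} {q} walk closes even =
    alternating λ k k<i+r → edge k k<i+r (<-≤-connex k i)
    where
    edge : ∀ k → suc k ≤ i + r → k < i ⊎ i ≤ k →
           Edge (alternate b k) (shortcut q i d k) (shortcut q i d (suc k))
    edge k _     (inj₁ k<i) =
      subst₂ (Edge (alternate b k)) (sym (shortcut-≤ q (<⇒≤ k<i))) (sym (shortcut-≤ q k<i))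
        (step walk k (≤-trans k<i (≤-trans (m≤m+n i d) (m≤m+n (i + d) r))))
    edge k k<i+r (inj₂ i≤k) =
      subst₂ (Edge (alternate b k)) (sym (shortcut-≥ closes i≤k))
                                    (sym (shortcut-≥ closes (m≤n⇒m≤1+n i≤k)))
        (subst (λ x → Edge x _ _) (alternate-+-Even b k even)
          (step walk (k + d) (≤-trans (+-monoˡ-≤ d k<i+r) (≤-reflexive (xy∙z≈xz∙y i r d)))))

  edgeAt : (ℕ → Vertex) → ℕ → Fin n × Fin n
  edgeAt q i = canon S (q i) (q (suc i))

  walkEdges-cong : ∀ l {q q′} → (∀ {k} → k ≤ l → q k ≡ q′ k) → walkEdges S l q ≡ walkEdges S l q′
  walkEdges-cong l {q} {q′} q≗q′ = begin
    walkEdges S l q          ≡⟨ map-upTo (edgeAt q) l ⟩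
    applyUpTo (edgeAt q) l   ≡⟨ applyUpTo-cong _ _ l (λ k<l →
                                  cong₂ (canon S) (q≗q′ (<⇒≤ k<l)) (q≗q′ k<l)) ⟩
    applyUpTo (edgeAt q′) l  ≡⟨ map-upTo (edgeAt q′) l ⟨
    walkEdges S l q′         ∎
    where open ≡-Reasoning

  walkEdges-++ : ∀ l m q → walkEdges S (l + m) q ≡ walkEdges S l q ++ walkEdges S m (λ k → q (k + l))
  walkEdges-++ l m q = begin
    walkEdges S (l + m) q
      ≡⟨ map-upTo (edgeAt q) (l + m) ⟩
    applyUpTo (edgeAt q) (l + m)
      ≡⟨ applyUpTo-++ (edgeAt q) l m ⟩
    applyUpTo (edgeAt q) l ++ applyUpTo (λ k → edgeAt q (l + k)) m
      ≡⟨ cong₂ _++_ (map-upTo (edgeAt q) l)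
                    (applyUpTo-cong _ _ m (λ {k} _ → cong (edgeAt q) (+-comm k l))) ⟨
    walkEdges S l q ++ applyUpTo (edgeAt (λ k → q (k + l))) m
      ≡⟨ cong (walkEdges S l q ++_) (map-upTo _ m) ⟨
    walkEdges S l q ++ walkEdges S m (λ k → q (k + l))
      ∎
    where open ≡-Reasoning

  Decomposes-insertCycle : ∀ xs ys → Decomposes S (xs ++ ys) → (C : AltGCycle S) →
                           Decomposes S (xs ++ cycleEdges S C ++ ys)
  Decomposes-insertCycle xs ys (π , cs , perm) C = π , C ∷ cs ,
    ↭-trans (shifts (pathEdges S π) (cycleEdges S C))
      (↭-trans (++⁺ˡ (cycleEdges S C) perm) (shifts (cycleEdges S C) xs))

  record FirstRepeat (l : ℕ) (q : ℕ → Vertex) : Set where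
    field
      i d       : ℕ
      0<d       : 0 < d
      bound     : i + d ≤ l
      closes    : q i ≡ q (i + d)
      injective : InjectiveBelow (i + d) q

  FirstRepeat-weaken : ∀ {l q} → FirstRepeat l q → FirstRepeat (suc l) q
  FirstRepeat-weaken rep = record { FirstRepeat rep; bound = m≤n⇒m≤1+n (FirstRepeat.bound rep) }

  injectiveBelow-extend : ∀ {N q} → InjectiveBelow N q → (∀ i → i < N → ¬ q i ≡ q N) →
                          InjectiveBelow (suc N) q
  injectiveBelow-extend {N} injective fresh i j (s≤s i≤N) (s≤s j≤N) eq
    with m≤n⇒m<n∨m≡n i≤N | m≤n⇒m<n∨m≡n j≤N
  ... | inj₁ i<N  | inj₁ j<N  = injective i j i<N j<N eq
  ... | inj₁ i<N  | inj₂ refl = ⊥-elim (fresh i i<N eq)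
  ... | inj₂ refl | inj₁ j<N  = ⊥-elim (fresh j j<N (sym eq))
  ... | inj₂ refl | inj₂ refl = refl

  firstRepeat : ∀ l q → InjectiveBelow (suc l) q ⊎ FirstRepeat l q
  firstRepeat zero q = inj₁ λ { .0 .0 (s≤s z≤n) (s≤s z≤n) _ → refl }
  firstRepeat (suc l) q with firstRepeat l q
  ... | inj₂ rep = inj₂ (FirstRepeat-weaken rep)
  ... | inj₁ injective with anyUpTo? (λ i → q i Fin.≟ q (suc l)) (suc l)
  ...   | no fresh = inj₁ (injectiveBelow-extend injective (λ i i<N eq → fresh (i , i<N , eq)))
  ...   | yes (i , s≤s i≤l , eq) with m≤n⇒∃[o]m+o≡n i≤l
  ...     | o , i+o≡l = inj₂ record
    { i         = i
    ; d         = suc o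
    ; 0<d       = z<s
    ; bound     = ≤-reflexive i+d≡l+1
    ; closes    = trans eq (cong q (sym i+d≡l+1))
    ; injective = subst (λ N → InjectiveBelow N q) (sym i+d≡l+1) injective
    }
    where
    i+d≡l+1 : i + suc o ≡ suc l
    i+d≡l+1 = trans (+-suc i o) (cong suc i+o≡l)

  module CycleRemoval {b i d r q} (walk : AlternatingWalk b (i + d + r) q) (closes : q i ≡ q (i + d))
                      (injective : InjectiveBelow (i + d) q) (0<d : 0 < d) where

    cycleWalk : AlternatingWalk (alternate b i) d (λ k → q (k + i))
    cycleWalk = shiftWalk walk i (m≤m+n (i + d) r)

    cycleClosed : q (d + i) ≡ q i
    cycleClosed = trans (cong q (+-comm d i)) (sym closes)

    cycle : AltGCycle S
    cycle = closedWalk⇒cycle cycleWalk cycleClosed (shiftInjective i d injective) 0<d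

    shortcutWalk : AlternatingWalk b (i + r) (shortcut q i d)
    shortcutWalk = shortcut-alternating walk closes (closedWalk-even cycleWalk cycleClosed)

    prefix suffix : List (Fin n × Fin n)
    prefix = walkEdges S i q
    suffix = walkEdges S r (λ k → q (k + (i + d)))

    shortcutEdges : walkEdges S (i + r) (shortcut q i d) ≡ prefix ++ suffix
    shortcutEdges = trans (walkEdges-++ i r (shortcut q i d))
      (cong₂ _++_ (walkEdges-cong i (shortcut-≤ q))
                  (walkEdges-cong r λ {k} _ → trans (shortcut-≥ closes (m≤n+m i k)) (cong q (+-assoc k i d))))

    walkEdgesAroundCycle : walkEdges S (i + d + r) q ≡ prefix ++ cycleEdges S cycle ++ suffix
    walkEdgesAroundCycle = begin
      walkEdges S (i + d + r) q                       ≡⟨ walkEdges-++ (i + d) r q ⟩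
      walkEdges S (i + d) q ++ suffix                 ≡⟨ cong (_++ suffix) (walkEdges-++ i d q) ⟩
      (prefix ++ cycleEdges S cycle) ++ suffix        ≡⟨ ++-assoc prefix (cycleEdges S cycle) suffix ⟩
      prefix ++ cycleEdges S cycle ++ suffix          ∎
      where open ≡-Reasoning

    lift : Decomposes S (walkEdges S (i + r) (shortcut q i d)) → Decomposes S (walkEdges S (i + d + r) q)
    lift decomposition = subst (Decomposes S) (sym walkEdgesAroundCycle)
      (Decomposes-insertCycle prefix suffix (subst (Decomposes S) shortcutEdges decomposition) cycle)

  decompose : ∀ l b q → AlternatingWalk b l q → Decomposes S (walkEdges S l q)
  decompose = <-rec _ go
    where
    go : ∀ l → (∀ {l′} → l′ < l → ∀ b q → AlternatingWalk b l′ q → Decomposes S (walkEdges S l′ q)) →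
         ∀ b q → AlternatingWalk b l q → Decomposes S (walkEdges S l q)
    go l rec b q walk with firstRepeat l q
    ... | inj₁ injective = injectiveWalk⇒path walk injective , [] , ↭-reflexive (++-identityʳ _)
    ... | inj₂ rep with m≤n⇒∃[o]m+o≡n (FirstRepeat.bound rep)
    ...   | r , split = subst (λ L → Decomposes S (walkEdges S L q)) split
                          (lift (rec shorter b (shortcut q i d) shortcutWalk))
      where
      open FirstRepeat rep
      open CycleRemoval (subst (λ L → AlternatingWalk b L q) (sym split) walk) closes injective 0<d
      shorter : i + r < l
      shorter = subst (i + r <_) split (+-monoˡ-< r (m<m+n i 0<d))

  LayeredEdge : Bool → LV S → LV S → Set
  LayeredEdge true  = LX S
  LayeredEdge false = LY S

  LayeredEdge-project : ∀ x {a a′} → LayeredEdge x a a′ → Edge x (proj₁ a) (proj₁ a′)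
  LayeredEdge-project true  (_ , _ , _ , aa′∈A , _)                 = aa′∈A
  LayeredEdge-project false (_ , _ , inj₁ (_ , _ , _ , aa′∈B , _)) = aa′∈B
  LayeredEdge-project false (_ , _ , inj₂ (_ , _ , _ , a′a∈B , _)) = InB-sym a′a∈B

  LayeredEdge-next : ∀ x {a a′ a″} → LayeredEdge x a a′ →
                     (LX S a a′ × LY S a′ a″) ⊎ (LY S a a′ × LX S a′ a″) → LayeredEdge (not x) a′ a″
  LayeredEdge-next true  _  (inj₁ (_ , y)) = y
  LayeredEdge-next false _  (inj₂ (_ , x)) = x
  LayeredEdge-next true  x  (inj₂ (y , _)) =
    ⊥-elim (InA-InB-disjoint (LayeredEdge-project true x) (LayeredEdge-project false y))
  LayeredEdge-next false y  (inj₁ (x , _)) =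
    ⊥-elim (InA-InB-disjoint (LayeredEdge-project true x) (LayeredEdge-project false y))

  module _ (P : AltPath S) where
    open AltPath P

    alternatingLayeredEdges : ∀ {b} → LayeredEdge b (p 0) (p 1) →
                              ∀ i → suc i ≤ m → LayeredEdge (alternate b i) (p i) (p (suc i))
    alternatingLayeredEdges     first zero    _     = first
    alternatingLayeredEdges {b} first (suc i) i+1<m =
      LayeredEdge-next (alternate b i) (alternatingLayeredEdges first i (<⇒≤ i+1<m)) (alt i i+1<m)

    projectedWalk : Σ Bool λ b → AlternatingWalk b m (proj₁ ∘ p)
    projectedWalk with 1 ≤? m
    ... | no  m≢0 = true , alternating λ i i<m → ⊥-elim (m≢0 (≤-trans (s≤s z≤n) i<m))
    ... | yes 0<m with edge 0 0<m
    ...   | inj₁ x = true  , alternating λ i i<m →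
                       LayeredEdge-project (alternate true i) (alternatingLayeredEdges x i i<m)
    ...   | inj₂ y = false , alternating λ i i<m →
                       LayeredEdge-project (alternate false i) (alternatingLayeredEdges y i i<m)

lemma14 : (S : Setting) → (P : AltPath S) → Decomposes S (S-edges S P)
lemma14 S P with projectedWalk S P
... | b , walk = decompose S (AltPath.m P) b _ walk
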